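{- For any partition $\lambda$ of a positive integer $n$, $\mathcal{O}(\lambda)\equiv\mathcal{O}(\lambda')\pmod 4$ if and only if $\lambda$ has an even number of even hooks.
   Context: For a partition $\lambda$, $\lambda'$ denotes its conjugate partition and $\mathcal{O}(\lambda)$ denotes the number of odd parts of $\lambda$. For a cell $(i,j)$ of the Young diagram of $\lambda$, its hook length is $\lambda_i-j+\lambda'_j-i+1$. An even hook is a cell of the Young diagram whose hook length is even; the number of even hooks of $\lambda$ is the number of such cells. -}

module Defs where

open import Data.Nat using (ℕ; zero; suc; _+_; _∸_; _≤_; _≥_; _<_; _%_)
open import Data.Nat.Properties using (_≤?_)
open import Data.Nat.ListAction using (sum)
open import Data.List using (List; []; _∷_; length; filter; map; upTo; lookup; applyUpTo)
open import Data.List.Relation.Unary.All using (All)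
open import Data.List.Relation.Unary.Linked using (Linked)
open import Data.Fin using (Fin; toℕ)
open import Relation.Binary.PropositionalEquality using (_≡_)

record IsPartition (n : ℕ) (λs : List ℕ) : Set where
  field
    decreasing : Linked _≥_ λs
    positive   : All (λ p → 1 ≤ p) λs
    sums       : sum λs ≡ n

conjPart : List ℕ → ℕ → ℕ
conjPart λs j = length (filter (λ p → j ≤? p) λs)

conjugate : List ℕ → List ℕ
conjugate [] = []
conjugate λs@(p ∷ _) = applyUpTo (λ k → conjPart λs (suc k)) p

oddParts : List ℕ → ℕ
oddParts λs = length (filter (λ p → 1 ≤? p % 2) λs)

-- hook length of cell (i,j) (1-indexed, 1 ≤ j ≤ λ_i): λ_i - j + λ'_j - i + 1
hookLength : List ℕ → ℕ → ℕ → ℕ → ℕ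
hookLength λs i λi j = (λi + conjPart λs j + 1) ∸ (j + i)

evenHooksRow : List ℕ → ℕ → ℕ → ℕ
evenHooksRow λs i λi =
  length (filter (λ j → (hookLength λs i λi (suc j) % 2) ≤? 0) (upTo λi))

evenHooksFrom : List ℕ → ℕ → List ℕ → ℕ
evenHooksFrom λs i [] = 0
evenHooksFrom λs i (p ∷ ps) = evenHooksRow λs i p + evenHooksFrom λs (suc i) ps

evenHooks : List ℕ → ℕ
evenHooks λs = evenHooksFrom λs 1 λs

module Submission where

-- Write E for the number of even hooks of λ ⊢ n and 𝒪, 𝒪′ for the numbers of odd
-- parts of λ and λ′. The heart of the proof is the congruence
--   2E + 𝒪 + 𝒪′ ≡ 2n (mod 4),
-- shown by induction on the rows. Let λ₁ = p and let c_k be the length of column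
-- k + 1 below the first row. The first-row hooks are p − k + c_k, the first p columns
-- of λ have lengths c_k + 1 and those of the remaining partition have lengths c_k,
-- and a parity check on each first-row cell shows that the first row adds exactly
-- 2p to the left-hand side modulo 4. Since 𝒪 ≡ n (mod 2), also 2𝒪 ≡ 2n (mod 4),
-- hence 𝒪 ≡ 𝒪′ + 2E (mod 4), and 2E ≡ 0 (mod 4) exactly when E is even.

open import Defs
open import Data.Nat using (ℕ; zero; suc; _+_; _*_; _∸_; _%_; _≤_; _<_; _≥_; z≤n; s≤s)
open import Data.Nat.Properties
open import Algebra.Properties.CommutativeSemigroup +-commutativeSemigroup using (xy∙z≈xz∙y)
open import Data.Nat.DivMod using (%-distribˡ-+; [m+n]%n≡m%n; m%n%n≡m%n; m%n<n; m%n*o≡m*o%[n*o])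
open import Data.Nat.ListAction using (sum)
open import Data.Nat.Tactic.RingSolver using (solve-∀)
open import Data.List using (List; []; _∷_; length; filter; map; applyUpTo; upTo)
open import Data.List.Properties using (filter-accept; filter-none; map-applyUpTo)
open import Data.List.Relation.Unary.All as All using (All; []; _∷_)
open import Data.List.Relation.Unary.AllPairs using (AllPairs; []; _∷_)
open import Data.List.Relation.Unary.Linked.Properties using (Linked⇒AllPairs)
open import Data.Product using (_×_; _,_)
open import Data.Sum using (_⊎_; inj₁; inj₂)
open import Function using (_∘_; flip)
open import Level using (0ℓ)
open import Relation.Binary.Bundles using (Setoid)
open import Relation.Binary.Structures using (IsEquivalence)
import Relation.Binary.Reasoning.Setoid as SetoidReasoning
open import Relation.Binary.PropositionalEquality

-- A record rather than m % 4 ≡ n % 4 itself, so that unification can recover m and n.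
infix 4 _≡₄_
record _≡₄_ (m n : ℕ) : Set where
  constructor from-%4
  field to-%4 : m % 4 ≡ n % 4
open _≡₄_

≡₄-refl : ∀ {m} → m ≡₄ m
≡₄-refl = from-%4 refl

≡₄-sym : ∀ {m n} → m ≡₄ n → n ≡₄ m
≡₄-sym (from-%4 m≡n) = from-%4 (sym m≡n)

≡₄-trans : ∀ {m n o} → m ≡₄ n → n ≡₄ o → m ≡₄ o
≡₄-trans (from-%4 m≡n) (from-%4 n≡o) = from-%4 (trans m≡n n≡o)

≡₄-isEquivalence : IsEquivalence _≡₄_
≡₄-isEquivalence = record { refl = ≡₄-refl ; sym = ≡₄-sym ; trans = ≡₄-trans }

≡₄-setoid : Setoid 0ℓ 0ℓ
≡₄-setoid = record { isEquivalence = ≡₄-isEquivalence }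

module ≡₄-Reasoning = SetoidReasoning ≡₄-setoid

+-cong-≡₄ : ∀ {a b c d} → a ≡₄ b → c ≡₄ d → a + c ≡₄ b + d
+-cong-≡₄ {a} {b} {c} {d} (from-%4 a≡b) (from-%4 c≡d) = from-%4 (begin
  (a + c) % 4          ≡⟨ %-distribˡ-+ a c 4 ⟩
  (a % 4 + c % 4) % 4  ≡⟨ cong₂ (λ x y → (x + y) % 4) a≡b c≡d ⟩
  (b % 4 + d % 4) % 4  ≡⟨ %-distribˡ-+ b d 4 ⟨
  (b + d) % 4          ∎)
  where open ≡-Reasoning

suc-cancel-≡₄ : ∀ {m n} → suc m ≡₄ suc n → m ≡₄ n
suc-cancel-≡₄ {m} {n} 1+m≡1+n = from-%4 (begin
  m % 4            ≡⟨ [m+n]%n≡m%n m 4 ⟨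
  (m + 4) % 4      ≡⟨ cong (_% 4) (+-suc m 3) ⟩
  (suc m + 3) % 4  ≡⟨ to-%4 (+-cong-≡₄ 1+m≡1+n (≡₄-refl {3})) ⟩
  (suc n + 3) % 4  ≡⟨ cong (_% 4) (+-suc n 3) ⟨
  (n + 4) % 4      ≡⟨ [m+n]%n≡m%n n 4 ⟩
  n % 4            ∎)
  where open ≡-Reasoning

+-cancelʳ-≡₄ : ∀ {m n} k → m + k ≡₄ n + k → m ≡₄ n
+-cancelʳ-≡₄ {m} {n} zero    eq = subst₂ _≡₄_ (+-identityʳ m) (+-identityʳ n) eq
+-cancelʳ-≡₄ {m} {n} (suc k) eq =
  +-cancelʳ-≡₄ k (suc-cancel-≡₄ (subst₂ _≡₄_ (+-suc m k) (+-suc n k) eq))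

2*m%4≡m%2*2 : ∀ m → 2 * m % 4 ≡ m % 2 * 2
2*m%4≡m%2*2 m = trans (cong (_% 4) (*-comm 2 m)) (sym (m%n*o≡m*o%[n*o] m 2 2))

2*-≡₄⇒≡₂ : ∀ {m n} → 2 * m ≡₄ 2 * n → m % 2 ≡ n % 2
2*-≡₄⇒≡₂ {m} {n} (from-%4 eq) =
  *-cancelʳ-≡ (m % 2) (n % 2) 2 (trans (sym (2*m%4≡m%2*2 m)) (trans eq (2*m%4≡m%2*2 n)))

≡₂⇒2*-≡₄ : ∀ {m n} → m % 2 ≡ n % 2 → 2 * m ≡₄ 2 * n
≡₂⇒2*-≡₄ {m} {n} eq = from-%4 (trans (2*m%4≡m%2*2 m) (trans (cong (_* 2) eq) (sym (2*m%4≡m%2*2 n))))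

m%2≡0⊎m%2≡1 : ∀ m → m % 2 ≡ 0 ⊎ m % 2 ≡ 1
m%2≡0⊎m%2≡1 m with m % 2 | m%n<n m 2
... | 0 | _ = inj₁ refl
... | 1 | _ = inj₂ refl
... | suc (suc _) | s≤s (s≤s ())

length-filter-odd : ∀ {A : Set} (f : A → ℕ) xs →
  length (filter (λ x → 1 ≤? f x % 2) xs) ≡ sum (map (λ x → f x % 2) xs)
length-filter-odd f [] = refl
length-filter-odd f (x ∷ xs) with f x % 2 | m%2≡0⊎m%2≡1 (f x)
... | .0 | inj₁ refl = length-filter-odd f xs
... | .1 | inj₂ refl = cong suc (length-filter-odd f xs)

length-filter-even : ∀ {A : Set} (f : A → ℕ) xs →
  length (filter (λ x → f x % 2 ≤? 0) xs) ≡ sum (map (λ x → suc (f x) % 2) xs)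
length-filter-even f [] = refl
length-filter-even f (x ∷ xs) with f x % 2 | m%2≡0⊎m%2≡1 (f x) | %-distribˡ-+ 1 (f x) 2
... | .0 | inj₁ refl | suc-parity = cong₂ _+_ (sym suc-parity) (length-filter-even f xs)
... | .1 | inj₂ refl | suc-parity = cong₂ _+_ (sym suc-parity) (length-filter-even f xs)

oddParts-∷ : ∀ p ps → oddParts (p ∷ ps) ≡ p % 2 + oddParts ps
oddParts-∷ p ps = trans (length-filter-odd (λ x → x) (p ∷ ps))
  (cong (p % 2 +_) (sym (length-filter-odd (λ x → x) ps)))

oddParts-applyUpTo : ∀ (g : ℕ → ℕ) n → oddParts (applyUpTo g n) ≡ sum (applyUpTo (λ k → g k % 2) n)
oddParts-applyUpTo g n = trans (length-filter-odd (λ x → x) (applyUpTo g n))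
  (cong sum (map-applyUpTo g (_% 2) n))

evenHooksRow-sum : ∀ λs i q →
  evenHooksRow λs i q ≡ sum (applyUpTo (λ j → suc (hookLength λs i q (suc j)) % 2) q)
evenHooksRow-sum λs i q = trans (length-filter-even (λ j → hookLength λs i q (suc j)) (upTo q))
  (cong sum (map-applyUpTo (λ j → j) _ q))

applyUpTo-cong : ∀ {A : Set} {f g : ℕ → A} n → (∀ {k} → k < n → f k ≡ g k) →
  applyUpTo f n ≡ applyUpTo g n
applyUpTo-cong zero    f≡g = refl
applyUpTo-cong (suc n) f≡g = cong₂ _∷_ (f≡g (s≤s z≤n)) (applyUpTo-cong n (f≡g ∘ s≤s))

sum-applyUpTo-vanishing : ∀ (f : ℕ → ℕ) m n → (∀ k → f (m + k) ≡ 0) →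
  sum (applyUpTo f (m + n)) ≡ sum (applyUpTo f m)
sum-applyUpTo-vanishing f zero    zero    f≡0 = refl
sum-applyUpTo-vanishing f zero    (suc n) f≡0 =
  cong₂ _+_ (f≡0 0) (sum-applyUpTo-vanishing (f ∘ suc) zero n (f≡0 ∘ suc))
sum-applyUpTo-vanishing f (suc m) n f≡0 = cong (f 0 +_) (sum-applyUpTo-vanishing (f ∘ suc) m n f≡0)

-- Removing the first row of a Young diagram

conjPart-∷ : ∀ {j p} ps → j ≤ p → conjPart (p ∷ ps) j ≡ suc (conjPart ps j)
conjPart-∷ {j} ps j≤p = cong length (filter-accept (j ≤?_) j≤p)

conjPart-beyond : ∀ {j} λs → All (_< j) λs → conjPart λs j ≡ 0
conjPart-beyond {j} λs λs<j = cong length (filter-none (j ≤?_) (All.map <⇒≱ λs<j))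

hookLength-∷ : ∀ {p j} ps i q → suc j ≤ p →
  hookLength (p ∷ ps) (suc i) q (suc j) ≡ hookLength ps i q (suc j)
hookLength-∷ {j = j} ps i q j<p
  rewrite conjPart-∷ ps j<p | +-suc q (conjPart ps (suc j)) | +-suc j i = refl

evenHooksRow-∷ : ∀ {p} ps i q → q ≤ p → evenHooksRow (p ∷ ps) (suc i) q ≡ evenHooksRow ps i q
evenHooksRow-∷ {p} ps i q q≤p = begin
  evenHooksRow (p ∷ ps) (suc i) q
    ≡⟨ evenHooksRow-sum (p ∷ ps) (suc i) q ⟩
  sum (applyUpTo (λ j → suc (hookLength (p ∷ ps) (suc i) q (suc j)) % 2) q)
    ≡⟨ cong sum (applyUpTo-cong q λ j<q →
         cong (λ h → suc h % 2) (hookLength-∷ ps i q (≤-trans j<q q≤p))) ⟩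
  sum (applyUpTo (λ j → suc (hookLength ps i q (suc j)) % 2) q)
    ≡⟨ evenHooksRow-sum ps i q ⟨
  evenHooksRow ps i q ∎
  where open ≡-Reasoning

evenHooksFrom-∷ : ∀ {p} ps i qs → All (_≤ p) qs →
  evenHooksFrom (p ∷ ps) (suc i) qs ≡ evenHooksFrom ps i qs
evenHooksFrom-∷ ps i []       []            = refl
evenHooksFrom-∷ ps i (q ∷ qs) (q≤p ∷ qs≤p) =
  cong₂ _+_ (evenHooksRow-∷ ps i q q≤p) (evenHooksFrom-∷ ps (suc i) qs qs≤p)

hookLength-head : ∀ {k p} ps → k < p →
  hookLength (p ∷ ps) 1 p (suc k) ≡ (p ∸ k) + conjPart ps (suc k)
hookLength-head {k} {p} ps k<p = begin
  (p + conjPart (p ∷ ps) (suc k) + 1) ∸ (suc k + 1)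
    ≡⟨ cong (λ c → (p + c + 1) ∸ (suc k + 1)) (conjPart-∷ ps k<p) ⟩
  (p + suc c + 1) ∸ (suc k + 1)
    ≡⟨ cong₂ _∸_ (trans (+-comm _ 1) (cong suc (+-suc p c))) (+-comm (suc k) 1) ⟩
  (p + c) ∸ k
    ≡⟨ +-∸-comm c (<⇒≤ k<p) ⟩
  (p ∸ k) + c ∎
  where
  open ≡-Reasoning
  c : ℕ
  c = conjPart ps (suc k)

evenHooks-∷ : ∀ p ps → All (_≤ p) ps →
  evenHooks (p ∷ ps) ≡ sum (applyUpTo (λ k → suc ((p ∸ k) + conjPart ps (suc k)) % 2) p) + evenHooks ps
evenHooks-∷ p ps ps≤p = cong₂ _+_ headRow (evenHooksFrom-∷ ps 1 ps ps≤p)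
  where
  headRow : evenHooksRow (p ∷ ps) 1 p ≡ sum (applyUpTo (λ k → suc ((p ∸ k) + conjPart ps (suc k)) % 2) p)
  headRow = trans (evenHooksRow-sum (p ∷ ps) 1 p)
    (cong sum (applyUpTo-cong p (λ k<p → cong (λ h → suc h % 2) (hookLength-head ps k<p))))

oddParts-conjugate-∷ : ∀ p ps →
  oddParts (conjugate (p ∷ ps)) ≡ sum (applyUpTo (λ k → suc (conjPart ps (suc k)) % 2) p)
oddParts-conjugate-∷ p ps = trans (oddParts-applyUpTo (λ k → conjPart (p ∷ ps) (suc k)) p)
  (cong sum (applyUpTo-cong p (λ k<p → cong (_% 2) (conjPart-∷ ps k<p))))

oddParts-conjugate : ∀ {p} ps → AllPairs _≥_ ps → All (_≤ p) ps →
  oddParts (conjugate ps) ≡ sum (applyUpTo (λ k → conjPart ps (suc k) % 2) p)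
oddParts-conjugate {p} [] _ _ = sym (sum-applyUpTo-vanishing _ 0 p (λ _ → refl))
oddParts-conjugate {p} (q ∷ qs) (qs≤q ∷ _) (q≤p ∷ _) = begin
  oddParts (conjugate (q ∷ qs))                 ≡⟨ oddParts-applyUpTo (λ k → conjPart (q ∷ qs) (suc k)) q ⟩
  sum (applyUpTo f q)                           ≡⟨ sum-applyUpTo-vanishing f q (p ∸ q) beyond ⟨
  sum (applyUpTo f (q + (p ∸ q)))               ≡⟨ cong (sum ∘ applyUpTo f) (m+[n∸m]≡n q≤p) ⟩
  sum (applyUpTo f p)                           ∎
  where
  open ≡-Reasoning
  f : ℕ → ℕ
  f k = conjPart (q ∷ qs) (suc k) % 2
  beyond : ∀ k → f (q + k) ≡ 0
  beyond k = cong (_% 2) (conjPart-beyond (q ∷ qs)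
    (All.map (λ r≤q → s≤s (≤-trans r≤q (m≤m+n q k))) (≤-refl ∷ qs≤q)))

-- The congruence 2E + 𝒪(λ) + 𝒪(λ′) ≡ 2n (mod 4)

cell-contribution-bits : ∀ a b → a < 2 → b < 2 → 2 * ((a + b) % 2) + suc a % 2 + suc b % 2 ≡₄ 2 + a + b
cell-contribution-bits 0 0 _ _ = from-%4 refl
cell-contribution-bits 0 1 _ _ = from-%4 refl
cell-contribution-bits 1 0 _ _ = from-%4 refl
cell-contribution-bits 1 1 _ _ = from-%4 refl
cell-contribution-bits (suc (suc _)) _ (s≤s (s≤s ())) _
cell-contribution-bits _ (suc (suc _)) _ (s≤s (s≤s ()))

-- The first-row cell of hook length 1 + p + c, whose column has length 1 + c; the
-- terms suc p % 2 and p % 2 telescope along the row.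
cell-contribution : ∀ p c → 2 * (suc (suc p + c) % 2) + suc p % 2 + suc c % 2 ≡₄ 2 + p % 2 + c % 2
cell-contribution p c = begin
  2 * (suc (suc p + c) % 2) + suc p % 2 + suc c % 2
    ≡⟨ cong₂ _+_ (cong₂ _+_ (cong (2 *_) hookParity) (%-distribˡ-+ 1 p 2)) (%-distribˡ-+ 1 c 2) ⟩
  2 * ((p % 2 + c % 2) % 2) + suc (p % 2) % 2 + suc (c % 2) % 2
    ≈⟨ cell-contribution-bits (p % 2) (c % 2) (m%n<n p 2) (m%n<n c 2) ⟩
  2 + p % 2 + c % 2 ∎
  where
  open ≡₄-Reasoning
  hookParity : suc (suc p + c) % 2 ≡ (p % 2 + c % 2) % 2
  hookParity = trans (trans (cong (_% 2) (+-comm 2 (p + c))) ([m+n]%n≡m%n (p + c) 2)) (%-distribˡ-+ p c 2)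

firstRow-contribution : ∀ p (c : ℕ → ℕ) →
  2 * sum (applyUpTo (λ k → suc ((p ∸ k) + c k) % 2) p) + p % 2 + sum (applyUpTo (λ k → suc (c k) % 2) p)
    ≡₄ 2 * p + sum (applyUpTo (λ k → c k % 2) p)
firstRow-contribution zero    c = ≡₄-refl
firstRow-contribution (suc p) c = begin
  2 * (h + H) + suc p % 2 + (z + Z)         ≡⟨ regroup h H (suc p % 2) z Z ⟩
  (2 * h + suc p % 2 + z) + (2 * H + Z)     ≈⟨ +-cong-≡₄ (cell-contribution p (c 0)) ≡₄-refl ⟩
  (2 + p % 2 + w) + (2 * H + Z)             ≡⟨ regroup′ (p % 2) w H Z ⟩
  (2 + w) + (2 * H + p % 2 + Z)             ≈⟨ +-cong-≡₄ (≡₄-refl {2 + w}) (firstRow-contribution p (c ∘ suc)) ⟩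
  (2 + w) + (2 * p + W)                     ≡⟨ regroup″ p w W ⟩
  2 * suc p + (w + W)                       ∎
  where
  open ≡₄-Reasoning
  h H z Z w W : ℕ
  h = suc (suc p + c 0) % 2
  H = sum (applyUpTo (λ k → suc ((p ∸ k) + c (suc k)) % 2) p)
  z = suc (c 0) % 2
  Z = sum (applyUpTo (λ k → suc (c (suc k)) % 2) p)
  w = c 0 % 2
  W = sum (applyUpTo (λ k → c (suc k) % 2) p)
  regroup : ∀ h H a z Z → 2 * (h + H) + a + (z + Z) ≡ (2 * h + a + z) + (2 * H + Z)
  regroup = solve-∀
  regroup′ : ∀ a w H Z → (2 + a + w) + (2 * H + Z) ≡ (2 + w) + (2 * H + a + Z)
  regroup′ = solve-∀
  regroup″ : ∀ p w W → (2 + w) + (2 * p + W) ≡ 2 * suc p + (w + W)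
  regroup″ = solve-∀

hookInvariant : ∀ λs → AllPairs _≥_ λs →
  2 * evenHooks λs + oddParts λs + oddParts (conjugate λs) ≡₄ 2 * sum λs
hookInvariant []       _                  = ≡₄-refl
hookInvariant (p ∷ ps) (ps≤p ∷ decreasing) = begin
  2 * evenHooks (p ∷ ps) + oddParts (p ∷ ps) + oddParts (conjugate (p ∷ ps))
    ≡⟨ cong₂ _+_ (cong₂ (λ e o → 2 * e + o) (evenHooks-∷ p ps ps≤p) (oddParts-∷ p ps))
                 (oddParts-conjugate-∷ p ps) ⟩
  2 * (R + E) + (p % 2 + O) + Z
    ≡⟨ regroup R E (p % 2) O Z ⟩
  (2 * R + p % 2 + Z) + (2 * E + O)
    ≈⟨ +-cong-≡₄ (firstRow-contribution p c) (≡₄-refl {2 * E + O}) ⟩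
  (2 * p + W) + (2 * E + O)
    ≡⟨ cong (λ w → (2 * p + w) + (2 * E + O)) (oddParts-conjugate ps decreasing ps≤p) ⟨
  (2 * p + O′) + (2 * E + O)
    ≡⟨ regroup′ p O′ E O ⟩
  2 * p + (2 * E + O + O′)
    ≈⟨ +-cong-≡₄ (≡₄-refl {2 * p}) (hookInvariant ps decreasing) ⟩
  2 * p + 2 * sum ps
    ≡⟨ *-distribˡ-+ 2 p (sum ps) ⟨
  2 * sum (p ∷ ps) ∎
  where
  open ≡₄-Reasoning
  c : ℕ → ℕ
  c k = conjPart ps (suc k)
  R E O Z W O′ : ℕ
  R = sum (applyUpTo (λ k → suc ((p ∸ k) + c k) % 2) p)
  E = evenHooks ps
  O = oddParts ps
  Z = sum (applyUpTo (λ k → suc (c k) % 2) p)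
  W = sum (applyUpTo (λ k → c k % 2) p)
  O′ = oddParts (conjugate ps)
  regroup : ∀ R E a O Z → 2 * (R + E) + (a + O) + Z ≡ (2 * R + a + Z) + (2 * E + O)
  regroup = solve-∀
  regroup′ : ∀ p O′ E O → (2 * p + O′) + (2 * E + O) ≡ 2 * p + (2 * E + O + O′)
  regroup′ = solve-∀

oddParts-parity : ∀ λs → 2 * oddParts λs ≡₄ 2 * sum λs
oddParts-parity []       = ≡₄-refl
oddParts-parity (p ∷ ps) = begin
  2 * oddParts (p ∷ ps)            ≡⟨ cong (2 *_) (oddParts-∷ p ps) ⟩
  2 * (p % 2 + oddParts ps)        ≡⟨ *-distribˡ-+ 2 (p % 2) (oddParts ps) ⟩
  2 * (p % 2) + 2 * oddParts ps    ≈⟨ +-cong-≡₄ (≡₂⇒2*-≡₄ {p % 2} {p} (m%n%n≡m%n p 2)) (oddParts-parity ps) ⟩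
  2 * p + 2 * sum ps               ≡⟨ *-distribˡ-+ 2 p (sum ps) ⟨
  2 * sum (p ∷ ps)                 ∎
  where open ≡₄-Reasoning

oddParts-conjugate-≡₄ : ∀ λs → AllPairs _≥_ λs → 2 * evenHooks λs + oddParts (conjugate λs) ≡₄ oddParts λs
oddParts-conjugate-≡₄ λs decreasing = +-cancelʳ-≡₄ O (begin
  (2 * E + O′) + O      ≡⟨ xy∙z≈xz∙y (2 * E) O′ O ⟩
  2 * E + O + O′        ≈⟨ hookInvariant λs decreasing ⟩
  2 * sum λs            ≈⟨ oddParts-parity λs ⟨
  2 * O                 ≡⟨ cong (O +_) (+-identityʳ O) ⟩
  O + O                 ∎)
  where
  open ≡₄-Reasoning
  E O O′ : ℕ
  E = evenHooks λs
  O = oddParts λs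
  O′ = oddParts (conjugate λs)

theorem3p1 : (n : ℕ) → 1 ≤ n → (λs : List ℕ) → IsPartition n λs →
    ((oddParts λs % 4 ≡ oddParts (conjugate λs) % 4) → evenHooks λs % 2 ≡ 0)
    × (evenHooks λs % 2 ≡ 0 → oddParts λs % 4 ≡ oddParts (conjugate λs) % 4)
theorem3p1 _ _ λs partition = evenHooks-even , oddParts-≡₄
  where
  E O O′ : ℕ
  E = evenHooks λs
  O = oddParts λs
  O′ = oddParts (conjugate λs)
  2E+O′≡O : 2 * E + O′ ≡₄ O
  2E+O′≡O = oddParts-conjugate-≡₄ λs (Linked⇒AllPairs (flip ≤-trans) (IsPartition.decreasing partition))
  evenHooks-even : O % 4 ≡ O′ % 4 → E % 2 ≡ 0
  evenHooks-even O≡O′ = 2*-≡₄⇒≡₂ {E} {0} (+-cancelʳ-≡₄ O′ (≡₄-trans 2E+O′≡O (from-%4 O≡O′)))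
  oddParts-≡₄ : E % 2 ≡ 0 → O % 4 ≡ O′ % 4
  oddParts-≡₄ E-even =
    to-%4 (≡₄-trans (≡₄-sym 2E+O′≡O) (+-cong-≡₄ (≡₂⇒2*-≡₄ {E} {0} E-even) (≡₄-refl {O′})))
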